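{- Let $G$ be a connected graph with at least three vertices such that each vertex is either a cut-vertex or a simplicial vertex. If $e$ is an edge of $G$ that is not a cut edge, then $\gamma_c(G)\leq\gamma_c(G-e)\leq\gamma_c(G)+1$.
   Context: A vertex $v$ is simplicial if $N_G[v]$ induces a complete graph; a cut-vertex is a vertex whose removal increases the number of components; an edge $e$ is a cut edge if $G-e$ is disconnected. A connected dominating set is a set $D$ such that every vertex outside $D$ has a neighbour in $D$ and the induced subgraph on $D$ is connected; $\gamma_c$ is the minimum size of such a set. -}

module Defs where

open import Data.Nat using (ℕ; _≤_)
open import Data.Bool using (Bool; true; false; _∧_; _∨_; not; T)
open import Data.Fin using (Fin; _≟_)
open import Data.Fin.Subset using (Subset; ⊤; ⁅_⁆; _∈_; _∉_; _─_; ∣_∣)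
open import Data.Product using (Σ; ∃; _×_; _,_)
open import Relation.Nullary using (¬_; does)
open import Relation.Binary.PropositionalEquality using (_≡_; _≢_)

Adjacency : ℕ → Set
Adjacency n = Fin n → Fin n → Bool

SimpleGraph : ∀ {n} → Adjacency n → Set
SimpleGraph {n} A = (∀ u v → A u v ≡ A v u) × (∀ v → A v v ≡ false)

deleteEdge : ∀ {n} → Adjacency n → Fin n → Fin n → Adjacency n
deleteEdge A u v x y =
  A x y ∧ not ((does (x ≟ u) ∧ does (y ≟ v)) ∨ (does (x ≟ v) ∧ does (y ≟ u)))

-- Walks from x to y all of whose vertices lie in S (walks in the subgraph induced by S).
data Walk {n} (A : Adjacency n) (S : Subset n) : Fin n → Fin n → Set where
  here : ∀ {v} → v ∈ S → Walk A S v v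
  step : ∀ {u w v} → u ∈ S → T (A u w) → Walk A S w v → Walk A S u v

ConnectedOn : ∀ {n} → Adjacency n → Subset n → Set
ConnectedOn A S = ∀ u v → u ∈ S → v ∈ S → Walk A S u v

Connected : ∀ {n} → Adjacency n → Set
Connected A = ConnectedOn A ⊤

-- v is a cut-vertex: removing v increases the number of components, i.e.
-- two vertices other than v that were connected become disconnected in G - v.
CutVertex : ∀ {n} → Adjacency n → Fin n → Set
CutVertex {n} A v =
  Σ (Fin n) λ x → Σ (Fin n) λ y →
    x ≢ v × y ≢ v × Walk A ⊤ x y × ¬ Walk A (⊤ ─ ⁅ v ⁆) x y

Simplicial : ∀ {n} → Adjacency n → Fin n → Set
Simplicial A v = ∀ x y → T (A v x) → T (A v y) → x ≢ y → T (A x y)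

CutEdge : ∀ {n} → Adjacency n → Fin n → Fin n → Set
CutEdge A u v = ¬ Connected (deleteEdge A u v)

Dominating : ∀ {n} → Adjacency n → Subset n → Set
Dominating {n} A D = ∀ v → v ∉ D → Σ (Fin n) λ u → u ∈ D × T (A v u)

IsConnectedDominatingSet : ∀ {n} → Adjacency n → Subset n → Set
IsConnectedDominatingSet A D = Dominating A D × ConnectedOn A D

ConnDomNumber : ∀ {n} → Adjacency n → ℕ → Set
ConnDomNumber {n} A k =
  (Σ (Subset n) λ D → IsConnectedDominatingSet A D × ∣ D ∣ ≡ k)
  × (∀ D → IsConnectedDominatingSet A D → k ≤ ∣ D ∣)

-- A connected dominating set D of G contains every cut-vertex, so every vertex outside D is
-- simplicial. A connected dominating set of G - e is one of G, whence γc(G) ≤ γc(G - e).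
-- Conversely let D be a minimum one of G and e = uv. If an endpoint p of e is outside D, adding
-- any neighbour of p in G - e gives a connected dominating set of G - e. If u, v ∈ D, walk from
-- u to v in G - e (it is connected) and shortcut every excursion out of D: the excursion vertex x
-- is simplicial, so its two neighbours on the walk are adjacent in G, and in G - e unless they
-- are u and v, in which case x is a common neighbour of u and v and D ∪ {x} works.
module Submission where

open import Defs
open import Data.Nat using (ℕ; _≤_; _+_; s≤s; z≤n; _≤?_)
open import Data.Nat.Properties using (≤-trans; ≤-reflexive; m≤m+n; n≤1+n; +-suc; +-monoʳ-≤)
open import Data.Fin using (Fin; _≟_)
open import Data.Fin.Subset using (Subset; ⊤; inside; outside; _∈_; _∉_; _⊆_; _∪_; _-_; ⁅_⁆; ∣_∣)
open import Data.Fin.Subset.Properties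
  using (∈⊤; _∈?_; x∈⁅x⁆; x∈⁅y⁆⇒x≡y; p⊆p∪q; q⊆p∪q; x∈p∪q⁻; ∣⁅x⁆∣≡1; x∈p∧x≢y⇒x∈p-y)
open import Data.Bool using (T)
open import Data.Unit using (tt)
open import Data.Bool.Properties using (T-∧)
open import Data.Vec using (_∷_; [])
open import Data.Sum using (_⊎_; inj₁; inj₂; [_,_]; map₁)
open import Data.Product using (_×_; _,_; proj₁; ∃-syntax)
open import Data.Empty using (⊥-elim)
open import Function using (id; _∘_; const)
open import Function.Bundles using (_⇔_; mk⇔; Equivalence)
open import Relation.Binary.Core using (Rel; _⇒_)
open import Relation.Binary.Definitions using (Symmetric)
open import Relation.Nullary using (¬_; yes; no; Dec; does; contradiction)
open import Relation.Nullary.Decidable using (_×-dec_; _⊎-dec_; ¬?; decidable-stable)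
open import Relation.Binary.PropositionalEquality using (_≡_; refl; sym; subst; _≢_; ≢-sym)

private variable
  n : ℕ
  A B : Adjacency n
  S S′ D D′ : Subset n
  a b p q u v w x y : Fin n

Edge : Adjacency n → Rel (Fin n) _
Edge A x y = T (A x y)

∣p∪q∣≤∣p∣+∣q∣ : (p q : Subset n) → ∣ p ∪ q ∣ ≤ ∣ p ∣ + ∣ q ∣
∣p∪q∣≤∣p∣+∣q∣ []            []            = z≤n
∣p∪q∣≤∣p∣+∣q∣ (inside  ∷ p) (inside  ∷ q) =
  s≤s (≤-trans (∣p∪q∣≤∣p∣+∣q∣ p q) (+-monoʳ-≤ ∣ p ∣ (n≤1+n _)))
∣p∪q∣≤∣p∣+∣q∣ (inside  ∷ p) (outside ∷ q) = s≤s (∣p∪q∣≤∣p∣+∣q∣ p q)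
∣p∪q∣≤∣p∣+∣q∣ (outside ∷ p) (inside  ∷ q) =
  ≤-trans (s≤s (∣p∪q∣≤∣p∣+∣q∣ p q)) (≤-reflexive (sym (+-suc ∣ p ∣ ∣ q ∣)))
∣p∪q∣≤∣p∣+∣q∣ (outside ∷ p) (outside ∷ q) = ∣p∪q∣≤∣p∣+∣q∣ p q

∣p∪⁅x⁆∣≤∣p∣+1 : (p : Subset n) (x : Fin n) → ∣ p ∪ ⁅ x ⁆ ∣ ≤ ∣ p ∣ + 1
∣p∪⁅x⁆∣≤∣p∣+1 p x =
  subst (λ m → ∣ p ∪ ⁅ x ⁆ ∣ ≤ ∣ p ∣ + m) (∣⁅x⁆∣≡1 x) (∣p∪q∣≤∣p∣+∣q∣ p ⁅ x ⁆)

SameEdge : Fin n → Fin n → Fin n → Fin n → Set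
SameEdge u v x y = (x ≡ u × y ≡ v) ⊎ (x ≡ v × y ≡ u)

sameEdge? : (u v x y : Fin n) → Dec (SameEdge u v x y)
sameEdge? u v x y = (x ≟ u ×-dec y ≟ v) ⊎-dec (x ≟ v ×-dec y ≟ u)

SameEdge-sym : SameEdge u v x y → SameEdge u v y x
SameEdge-sym (inj₁ (x≡u , y≡v)) = inj₂ (y≡v , x≡u)
SameEdge-sym (inj₂ (x≡v , y≡u)) = inj₁ (y≡u , x≡v)

T-does : ∀ {P : Set} (P? : Dec P) → T (does P?) ⇔ P
T-does (yes p)  = mk⇔ (const p) (const tt)
T-does (no ¬p) = mk⇔ (λ ()) ¬p

module DeleteEdge (A : Adjacency n) (u v : Fin n) where

  T-deleteEdge : Edge (deleteEdge A u v) x y ⇔ (Edge A x y × ¬ SameEdge u v x y)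
  T-deleteEdge {x} {y} = mk⇔
    (λ e → let (e′ , kept) = Equivalence.to T-∧ e in e′ , Equivalence.to ¬same⇔ kept)
    (λ (e , ¬same) → Equivalence.from T-∧ (e , Equivalence.from ¬same⇔ ¬same))
    where ¬same⇔ = T-does (¬? (sameEdge? u v x y))

  deleteEdge-⊆ : Edge (deleteEdge A u v) ⇒ Edge A
  deleteEdge-⊆ = proj₁ ∘ Equivalence.to T-deleteEdge

  deleteEdge-keeps : Edge A x y → ¬ SameEdge u v x y → Edge (deleteEdge A u v) x y
  deleteEdge-keeps e ¬same = Equivalence.from T-deleteEdge (e , ¬same)

  deleteEdge-keeps-avoiding₁ : Edge A x y → x ≢ u → y ≢ u → Edge (deleteEdge A u v) x y
  deleteEdge-keeps-avoiding₁ e x≢u y≢u = deleteEdge-keeps e λ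
    { (inj₁ (x≡u , _)) → x≢u x≡u ; (inj₂ (_ , y≡u)) → y≢u y≡u }

  deleteEdge-keeps-avoiding₂ : Edge A x y → x ≢ v → y ≢ v → Edge (deleteEdge A u v) x y
  deleteEdge-keeps-avoiding₂ e x≢v y≢v = deleteEdge-keeps e λ
    { (inj₁ (_ , y≡v)) → y≢v y≡v ; (inj₂ (x≡v , _)) → x≢v x≡v }

  deleteEdge-sym : Symmetric (Edge A) → Symmetric (Edge (deleteEdge A u v))
  deleteEdge-sym A-sym e with Equivalence.to T-deleteEdge e
  ... | e′ , ¬same = deleteEdge-keeps (A-sym e′) (¬same ∘ SameEdge-sym)

walk-head : Walk A S x y → x ∈ S
walk-head (here x∈S)     = x∈S
walk-head (step x∈S _ _) = x∈S

walk-edge : x ∈ S → y ∈ S → Edge A x y → Walk A S x y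
walk-edge x∈S y∈S e = step x∈S e (here y∈S)

_++ʷ_ : Walk A S x y → Walk A S y w → Walk A S x w
here _       ++ʷ W′ = W′
step x∈S e W ++ʷ W′ = step x∈S e (W ++ʷ W′)

walk-reverse : Symmetric (Edge A) → Walk A S x y → Walk A S y x
walk-reverse A-sym (here y∈S)     = here y∈S
walk-reverse A-sym (step x∈S e W) = walk-reverse A-sym W ++ʷ walk-edge (walk-head W) x∈S (A-sym e)

replaceEdges : S ⊆ S′ → (∀ {a b} → a ∈ S → b ∈ S → Edge A a b → Walk B S′ a b)
  → Walk A S x y → Walk B S′ x y
replaceEdges S⊆S′ replace (here y∈S)     = here (S⊆S′ y∈S)
replaceEdges S⊆S′ replace (step x∈S e W) = replace x∈S (walk-head W) e ++ʷ replaceEdges S⊆S′ replace W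

walk-mono : Edge B ⇒ Edge A → Walk B S x y → Walk A S x y
walk-mono B⊆A = replaceEdges id λ a∈S b∈S e → walk-edge a∈S b∈S (B⊆A e)

walk-firstEdge : Walk A S x y → x ≢ y → ∃[ w ] Edge A x w
walk-firstEdge (here _)     x≢x = ⊥-elim (x≢x refl)
walk-firstEdge (step _ e _) _   = _ , e

Reaches : Adjacency n → Subset n → Fin n → Subset n → Set
Reaches B S a D = ∃[ d ] d ∈ D × Walk B S a d

walk-via : Symmetric (Edge B) → D ⊆ D′
  → (∀ {a b} → a ∈ D → b ∈ D → Edge A a b → Walk B D′ a b)
  → ConnectedOn A D → Reaches B D′ a D → Reaches B D′ b D → Walk B D′ a b
walk-via B-sym D⊆D′ lift conn (d , d∈D , Wa) (d′ , d′∈D , Wb) =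
  Wa ++ʷ (replaceEdges D⊆D′ lift (conn d d′ d∈D d′∈D) ++ʷ walk-reverse B-sym Wb)

IsCDS-mono : Edge B ⇒ Edge A → IsConnectedDominatingSet B D → IsConnectedDominatingSet A D
IsCDS-mono B⊆A (dom , conn) =
  (λ x x∉D → let (y , y∈D , e) = dom x x∉D in y , y∈D , B⊆A e) ,
  (λ a b a∈D b∈D → walk-mono B⊆A (conn a b a∈D b∈D))

cutVertex∈cds : Symmetric (Edge A) → IsConnectedDominatingSet A D → CutVertex A x → x ∈ D
cutVertex∈cds {A = A} {D = D} {x = x} A-sym (dom , conn) (y , z , y≢x , z≢x , _ , ¬avoid)
  with x ∈? D
... | yes x∈D = x∈D
... | no  x∉D = contradiction (walk-via A-sym D⊆G-x (λ a∈D b∈D → walk-edge (D⊆G-x a∈D) (D⊆G-x b∈D)) conn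
                                 (reachesD y≢x) (reachesD z≢x)) ¬avoid
  where
  D⊆G-x : D ⊆ ⊤ - x
  D⊆G-x {a} a∈D = x∈p∧x≢y⇒x∈p-y ∈⊤ λ { refl → x∉D a∈D }

  reachesD : a ≢ x → Reaches A (⊤ - x) a D
  reachesD {a} a≢x with a ∈? D
  ... | yes a∈D = a , a∈D , here (D⊆G-x a∈D)
  ... | no  a∉D = let (d , d∈D , e) = dom a a∉D
                  in d , d∈D , walk-edge (x∈p∧x≢y⇒x∈p-y ∈⊤ a≢x) (D⊆G-x d∈D) e

ConnectedOn-grow : Symmetric (Edge B) → D ⊆ D′ → (∀ {a} → a ∈ D′ → Reaches B D′ a D)
  → (∀ {a b} → a ∈ D → b ∈ D → Edge A a b → Walk B D′ a b)
  → ConnectedOn A D → ConnectedOn B D′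
ConnectedOn-grow B-sym D⊆D′ reach lift conn a b a∈D′ b∈D′ =
  walk-via B-sym D⊆D′ lift conn (reach a∈D′) (reach b∈D′)

∪⁅⁆-reaches : Reaches B (D ∪ ⁅ w ⁆) w D → a ∈ D ∪ ⁅ w ⁆ → Reaches B (D ∪ ⁅ w ⁆) a D
∪⁅⁆-reaches {D = D} {w = w} w-reaches a∈D′ with x∈p∪q⁻ D ⁅ w ⁆ a∈D′
... | inj₁ a∈D   = _ , a∈D , here a∈D′
... | inj₂ a∈⁅w⁆ with x∈⁅y⁆⇒x≡y w a∈⁅w⁆
... | refl = w-reaches

cds-∪-neighbour : Symmetric (Edge B)
  → (∀ {a b} → Edge A a b → a ≢ p → b ≢ p → Edge B a b)
  → IsConnectedDominatingSet A D → p ∉ D → Edge B p w → w ≢ p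
  → IsConnectedDominatingSet B (D ∪ ⁅ w ⁆)
cds-∪-neighbour {B = B} {A = A} {p = p} {D = D} {w = w} B-sym keeps (dom , conn) p∉D pw w≢p =
  dom′ , ConnectedOn-grow B-sym D⊆D′ (∪⁅⁆-reaches w-reaches) lift conn
  where
  D⊆D′ : D ⊆ D ∪ ⁅ w ⁆
  D⊆D′ = p⊆p∪q ⁅ w ⁆

  w∈D′ : w ∈ D ∪ ⁅ w ⁆
  w∈D′ = q⊆p∪q D ⁅ w ⁆ (x∈⁅x⁆ w)

  ∈D⇒≢p : a ∈ D → a ≢ p
  ∈D⇒≢p a∈D refl = p∉D a∈D

  dom′ : Dominating B (D ∪ ⁅ w ⁆)
  dom′ x x∉D′ with x ≟ p
  ... | yes refl = w , w∈D′ , pw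
  ... | no  x≢p  = let (y , y∈D , e) = dom x (x∉D′ ∘ D⊆D′) in y , D⊆D′ y∈D , keeps e x≢p (∈D⇒≢p y∈D)

  w-reaches : Reaches B (D ∪ ⁅ w ⁆) w D
  w-reaches with w ∈? D
  ... | yes w∈D = w , w∈D , here w∈D′
  ... | no  w∉D = let (y , y∈D , e) = dom w w∉D
                  in y , y∈D , walk-edge w∈D′ (D⊆D′ y∈D) (keeps e w≢p (∈D⇒≢p y∈D))

  lift : a ∈ D → b ∈ D → Edge A a b → Walk B (D ∪ ⁅ w ⁆) a b
  lift a∈D b∈D e = walk-edge (D⊆D′ a∈D) (D⊆D′ b∈D) (keeps e (∈D⇒≢p a∈D) (∈D⇒≢p b∈D))

SimpleGraph⇒symmetric : SimpleGraph A → Symmetric (Edge A)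
SimpleGraph⇒symmetric (A-sym , _) {x} {y} = subst T (A-sym x y)

SimpleGraph⇒edge⇒≢ : SimpleGraph A → Edge A x y → x ≢ y
SimpleGraph⇒edge⇒≢ (_ , loopless) e refl = subst T (loopless _) e

CDS≤ : Adjacency n → ℕ → Set
CDS≤ B k = ∃[ D ] IsConnectedDominatingSet B D × ∣ D ∣ ≤ k

CommonNeighbour : Adjacency n → Fin n → Fin n → Set
CommonNeighbour B u v = ∃[ w ] Edge B u w × Edge B w v

module _ {n : ℕ} (A : Adjacency n) (simple : SimpleGraph A) (u v : Fin n) where
  open DeleteEdge A u v

  private
    A-sym : Symmetric (Edge A)
    A-sym = SimpleGraph⇒symmetric simple

    A∖uv : Adjacency n
    A∖uv = deleteEdge A u v

    A∖uv-sym : Symmetric (Edge A∖uv)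
    A∖uv-sym = deleteEdge-sym A-sym

  cds-deleteEdge-rerouted : IsConnectedDominatingSet A D → u ∈ D → v ∈ D → D ⊆ D′
    → (∀ {a} → a ∈ D′ → Reaches A∖uv D′ a D) → Walk A∖uv D′ u v
    → IsConnectedDominatingSet A∖uv D′
  cds-deleteEdge-rerouted {D = D} {D′ = D′} (dom , conn) u∈D v∈D D⊆D′ reach W =
    dom′ , ConnectedOn-grow A∖uv-sym D⊆D′ reach lift conn
    where
    dom′ : Dominating A∖uv D′
    dom′ x x∉D′ = let (y , y∈D , e) = dom x (x∉D′ ∘ D⊆D′) in y , D⊆D′ y∈D , deleteEdge-keeps e λ
      { (inj₁ (refl , _)) → x∉D′ (D⊆D′ u∈D) ; (inj₂ (refl , _)) → x∉D′ (D⊆D′ v∈D) }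

    lift : a ∈ D → b ∈ D → Edge A a b → Walk A∖uv D′ a b
    lift {a} {b} a∈D b∈D e with sameEdge? u v a b
    ... | yes (inj₁ (refl , refl)) = W
    ... | yes (inj₂ (refl , refl)) = walk-reverse A∖uv-sym W
    ... | no  ¬same                = walk-edge (D⊆D′ a∈D) (D⊆D′ b∈D) (deleteEdge-keeps e ¬same)

  module _ {D : Subset n} (outside-simplicial : ∀ x → x ∉ D → Simplicial A x) where
    mutual
      shortcut : a ∈ D → b ∈ D → Walk A∖uv ⊤ a b → Walk A∖uv D a b ⊎ CommonNeighbour A∖uv u v
      shortcut a∈D b∈D (here _)      = inj₁ (here a∈D)
      shortcut a∈D b∈D (step _ ay W) = shortcut-edge a∈D b∈D ay W

      shortcut-edge : a ∈ D → b ∈ D → Edge A∖uv a y → Walk A∖uv ⊤ y b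
        → Walk A∖uv D a b ⊎ CommonNeighbour A∖uv u v
      shortcut-edge {y = y} a∈D b∈D ay W with y ∈? D
      ... | yes y∈D = map₁ (step a∈D ay) (shortcut y∈D b∈D W)
      ... | no  y∉D = shortcut-simplicial a∈D b∈D ay (outside-simplicial y y∉D) y∉D W

      shortcut-simplicial : a ∈ D → b ∈ D → Edge A∖uv a x → Simplicial A x → x ∉ D → Walk A∖uv ⊤ x b
        → Walk A∖uv D a b ⊎ CommonNeighbour A∖uv u v
      shortcut-simplicial a∈D b∈D ax x-simplicial x∉D (here _) = contradiction b∈D x∉D
      shortcut-simplicial {a = a} {x = x} a∈D b∈D ax x-simplicial x∉D (step {w = y} _ xy W) with a ≟ y
      ... | yes refl = shortcut a∈D b∈D W
      ... | no  a≢y with sameEdge? u v a y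
      ... | yes (inj₁ (refl , refl)) = inj₂ (x , ax , xy)
      ... | yes (inj₂ (refl , refl)) = inj₂ (x , A∖uv-sym xy , A∖uv-sym ax)
      ... | no  ¬same = shortcut-edge a∈D b∈D ay W
        where ay = deleteEdge-keeps (x-simplicial a y (A-sym (deleteEdge-⊆ ax)) (deleteEdge-⊆ xy) a≢y) ¬same

    cds≤-endpointOutside : p ∉ D → (∀ {a b} → Edge A a b → a ≢ p → b ≢ p → Edge A∖uv a b)
      → IsConnectedDominatingSet A D → Walk A∖uv ⊤ p q → p ≢ q → CDS≤ A∖uv (∣ D ∣ + 1)
    cds≤-endpointOutside p∉D keeps cds W p≢q =
      let (w , pw) = walk-firstEdge W p≢q
      in D ∪ ⁅ w ⁆
       , cds-∪-neighbour A∖uv-sym keeps cds p∉D pw (≢-sym (SimpleGraph⇒edge⇒≢ simple (deleteEdge-⊆ pw)))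
       , ∣p∪⁅x⁆∣≤∣p∣+1 D w

    cds≤-endpointsInside : IsConnectedDominatingSet A D → u ∈ D → v ∈ D → Walk A∖uv ⊤ u v
      → CDS≤ A∖uv (∣ D ∣ + 1)
    cds≤-endpointsInside cds u∈D v∈D W with shortcut u∈D v∈D W
    ... | inj₁ W′ =
      D , cds-deleteEdge-rerouted cds u∈D v∈D id (λ a∈D → _ , a∈D , here a∈D) W′ , m≤m+n ∣ D ∣ 1
    ... | inj₂ (w , uw , wv) =
      D ∪ ⁅ w ⁆
      , cds-deleteEdge-rerouted cds u∈D v∈D D⊆D′ (∪⁅⁆-reaches w-reaches) u-w-v
      , ∣p∪⁅x⁆∣≤∣p∣+1 D w
      where
      D⊆D′ : D ⊆ D ∪ ⁅ w ⁆
      D⊆D′ = p⊆p∪q ⁅ w ⁆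

      w∈D′ : w ∈ D ∪ ⁅ w ⁆
      w∈D′ = q⊆p∪q D ⁅ w ⁆ (x∈⁅x⁆ w)

      w-reaches : Reaches A∖uv (D ∪ ⁅ w ⁆) w D
      w-reaches = u , u∈D , walk-edge w∈D′ (D⊆D′ u∈D) (A∖uv-sym uw)

      u-w-v : Walk A∖uv (D ∪ ⁅ w ⁆) u v
      u-w-v = step (D⊆D′ u∈D) uw (walk-edge w∈D′ (D⊆D′ v∈D) wv)

    cds≤-deleteEdge : Edge A u v → IsConnectedDominatingSet A D → Connected A∖uv → CDS≤ A∖uv (∣ D ∣ + 1)
    cds≤-deleteEdge uv cds conn with u ∈? D | v ∈? D
    ... | no u∉D  | _       = cds≤-endpointOutside u∉D deleteEdge-keeps-avoiding₁ cds (conn u v ∈⊤ ∈⊤) u≢v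
      where u≢v = SimpleGraph⇒edge⇒≢ simple uv
    ... | yes _   | no v∉D  = cds≤-endpointOutside v∉D deleteEdge-keeps-avoiding₂ cds (conn v u ∈⊤ ∈⊤) v≢u
      where v≢u = ≢-sym (SimpleGraph⇒edge⇒≢ simple uv)
    ... | yes u∈D | yes v∈D = cds≤-endpointsInside cds u∈D v∈D (conn u v ∈⊤ ∈⊤)

lemma4p3 : (n : ℕ) → 3 ≤ n → (A : Adjacency n) → SimpleGraph A → Connected A
    → (∀ v → CutVertex A v ⊎ Simplicial A v)
    → (u v : Fin n) → T (A u v) → ¬ CutEdge A u v
    → (k k′ : ℕ) → ConnDomNumber A k → ConnDomNumber (deleteEdge A u v) k′
    → k ≤ k′ × k′ ≤ k + 1
lemma4p3 n _ A simple _ cut-or-simplicial u v uv ¬cutEdge k k′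
         ((D , cds , refl) , minimal) ((D′ , cds′ , refl) , minimal′) =
  minimal D′ (IsCDS-mono deleteEdge-⊆ cds′) ,
  decidable-stable (∣ D′ ∣ ≤? ∣ D ∣ + 1) (λ k′≰k+1 → ¬cutEdge (k′≰k+1 ∘ k′≤k+1))
  where
  open DeleteEdge A u v

  outside-simplicial : ∀ x → x ∉ D → Simplicial A x
  outside-simplicial x x∉D =
    [ (λ cut → contradiction (cutVertex∈cds (SimpleGraph⇒symmetric simple) cds cut) x∉D) , id ] (cut-or-simplicial x)

  k′≤k+1 : Connected (deleteEdge A u v) → ∣ D′ ∣ ≤ ∣ D ∣ + 1
  k′≤k+1 conn =
    let (D″ , cds″ , size) = cds≤-deleteEdge A simple u v outside-simplicial uv cds conn
    in ≤-trans (minimal′ D″ cds″) size
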